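{- Let $\mathcal{G}=(G_1,\dots,G_r)$ be a sequence of graphs on a common vertex set $V$, and let $\sigma$ be real. For a real $\gamma$, let $S(\gamma)\subseteq V$ be an optimal solution of $\mathrm{SDS}(\gamma)$: minimize $b(S,\mathcal{G})-\gamma|S|$ over $S\subseteq V$ subject to $\sum_{i=1}^r m(S,G_i)\ge\sigma|S|$. Let $S^*$ be an optimal solution of SDS: a nonempty $S\subseteq V$ with $d(S,\mathcal{G})\ge\sigma$ minimizing $\Delta(S,\mathcal{G})$. Set $\gamma^*=\Delta(S^*,\mathcal{G})$. 1. If $\gamma<\gamma^*$, then $S(\gamma)=\emptyset$. 2. If $\gamma>\gamma^*$, then $S(\gamma)\ne\emptyset$ and $\Delta(S(\gamma),\mathcal{G})<\gamma$.
   Context: Each $G_i=(V,E_i)$ is a simple undirected graph. For $S\subseteq V$, $m(S,G_i)$ is the number of edges of $E_i$ with both endpoints in $S$. The edge difference is $b(S,\mathcal{G})=\max_i m(S,G_i)-\min_i m(S,G_i)$. For nonempty $S$, the density is $d(S,G_i)=m(S,G_i)/|S|$. The total density is $d(S,\mathcal{G})=\sum_i d(S,G_i)$. The density difference is $\Delta(S,\mathcal{G})=\max_i d(S,G_i)-\min_i d(S,G_i)$.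
   Formalization: The parameters σ and γ are rational instead of real. -}

module Defs where

open import Data.Bool using (Bool; true; false; _∧_; if_then_else_)
open import Data.Nat using (ℕ; zero; suc; _<ᵇ_; _∸_; _⊔_; _⊓_)
open import Data.Fin using (Fin; toℕ)
open import Data.Fin.Subset using (Subset; ∣_∣; Nonempty)
open import Data.Vec using (lookup)
open import Data.List using (List; map; allFin; foldr)
open import Data.Nat.ListAction using (sum)
open import Data.Integer using (+_)
open import Data.Rational as ℚ using (ℚ; 0ℚ)
open import Data.Product using (_×_)
open import Relation.Binary.PropositionalEquality using (_≡_)

record SimpleGraph (n : ℕ) : Set where
  field
    adj    : Fin n → Fin n → Bool
    sym    : ∀ i j → adj i j ≡ adj j i
    irrefl : ∀ i → adj i i ≡ false
open SimpleGraph public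

Σᵥ : ∀ {n} → (Fin n → ℕ) → ℕ
Σᵥ {n} f = sum (map f (allFin n))

-- m(S,G): number of edges {i,j} (counted once, via toℕ i < toℕ j)
-- with both endpoints in S
m : ∀ {n} → Subset n → SimpleGraph n → ℕ
m S G = Σᵥ λ i → Σᵥ λ j →
  if (toℕ i <ᵇ toℕ j) ∧ lookup S i ∧ lookup S j ∧ adj G i j then 1 else 0

-- A sequence of r+1 graphs G_0..G_r (the paper's G_1..G_r, r ≥ 1)
Graphs : ℕ → ℕ → Set
Graphs n r = Fin (suc r) → SimpleGraph n

maxℕ minℕ : ∀ {r} → (Fin (suc r) → ℕ) → ℕ
maxℕ {r} f = foldr _⊔_ (f Fin.zero) (map f (allFin (suc r)))
  where import Data.Fin as Fin
minℕ {r} f = foldr _⊓_ (f Fin.zero) (map f (allFin (suc r)))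
  where import Data.Fin as Fin

maxℚ minℚ : ∀ {r} → (Fin (suc r) → ℚ) → ℚ
maxℚ {r} f = foldr ℚ._⊔_ (f Fin.zero) (map f (allFin (suc r)))
  where import Data.Fin as Fin
minℚ {r} f = foldr ℚ._⊓_ (f Fin.zero) (map f (allFin (suc r)))
  where import Data.Fin as Fin

sumℚ : ∀ {r} → (Fin (suc r) → ℚ) → ℚ
sumℚ {r} f = foldr ℚ._+_ 0ℚ (map f (allFin (suc r)))

ℕ→ℚ : ℕ → ℚ
ℕ→ℚ k = + k ℚ./ 1

-- a / b as a rational; only ever used with b = |S| ≥ 1
-- (value 0 for b = 0 is an irrelevant convention)
divℕ : ℕ → ℕ → ℚ
divℕ a zero    = 0ℚ
divℕ a (suc k) = + a ℚ./ suc k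

module _ {n r : ℕ} (𝒢 : Graphs n r) where

  b : Subset n → ℕ
  b S = maxℕ (λ i → m S (𝒢 i)) ∸ minℕ (λ i → m S (𝒢 i))

  mTot : Subset n → ℕ
  mTot S = sum (map (λ i → m S (𝒢 i)) (allFin (suc r)))

  dᵢ : Subset n → Fin (suc r) → ℚ
  dᵢ S i = divℕ (m S (𝒢 i)) ∣ S ∣

  d : Subset n → ℚ
  d S = sumℚ (dᵢ S)

  Δ : Subset n → ℚ
  Δ S = maxℚ (dᵢ S) ℚ.- minℚ (dᵢ S)

  FeasibleSDSγ : ℚ → Subset n → Set
  FeasibleSDSγ σ S = σ ℚ.* ℕ→ℚ ∣ S ∣ ℚ.≤ ℕ→ℚ (mTot S)

  objSDSγ : ℚ → Subset n → ℚ
  objSDSγ γ S = ℕ→ℚ (b S) ℚ.- γ ℚ.* ℕ→ℚ ∣ S ∣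

  IsOptSDSγ : ℚ → ℚ → Subset n → Set
  IsOptSDSγ σ γ S = FeasibleSDSγ σ S ×
    (∀ T → FeasibleSDSγ σ T → objSDSγ γ S ℚ.≤ objSDSγ γ T)

  IsOptSDS : ℚ → Subset n → Set
  IsOptSDS σ S = Nonempty S × σ ℚ.≤ d S ×
    (∀ T → Nonempty T → σ ℚ.≤ d T → Δ S ℚ.≤ Δ T)

{-# OPTIONS --safe #-}
-- For nonempty S everything in SDS(γ) is the corresponding SDS quantity scaled by |S|:
-- b(S,𝒢) = |S| Δ(S,𝒢) and Σᵢ m(S,Gᵢ) = |S| d(S,𝒢). So the objective of a nonempty S is
-- |S| (Δ(S,𝒢) − γ), its feasibility is the density constraint d(S,𝒢) ≥ σ, and the empty set
-- is feasible with objective 0. For γ < γ* a nonempty optimum would have objective ≤ 0,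
-- i.e. γ* ≤ Δ(S,𝒢) ≤ γ. For γ > γ* the set S* has negative objective, hence so does the
-- optimum S(γ), which forces S(γ) ≠ ∅ and Δ(S(γ),𝒢) < γ.
module Submission where

open import Defs
open import Data.Nat using (ℕ)
open import Data.Fin.Subset using (Subset; ⊥; Nonempty)
open import Data.Rational using (ℚ; _<_)
open import Data.Product using (_×_)
open import Relation.Binary.PropositionalEquality using (_≡_)

open import Data.Bool using (false; _∧_; if_then_else_)
open import Data.Bool.Properties using (∧-zeroʳ)
open import Data.Fin using (Fin; zero; suc; toℕ)
open import Data.Fin.Subset using (∣_∣; inside; outside)
open import Data.Fin.Subset.Properties using (Empty-unique; nonempty?; ∣⊥∣≡0)
open import Data.Integer as ℤ using (+_)
import Data.Integer.Properties as ℤ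
open import Data.List using (List; []; _∷_; map; foldr; allFin)
open import Data.Nat.ListAction using (sum)
open import Data.Nat as ℕ using (NonZero; _<ᵇ_)
import Data.Nat.Properties as ℕ
open import Data.Product using (_,_; proj₁)
open import Data.Rational as ℚ using (0ℚ; _+_; _*_; _-_; _≤_; Positive; NonNegative; toℚᵘ)
import Data.Rational.Properties as ℚ
open import Data.Rational.Solver using (module +-*-Solver)
open import Data.Rational.Unnormalised as ℚᵘ using (mkℚᵘ; *≡*)
import Data.Rational.Unnormalised.Properties as ℚᵘ
open import Data.Sum using (inj₁; inj₂)
open import Data.Vec using (_∷_; lookup; there)
open import Data.Vec.Properties using (lookup-replicate)
open import Relation.Binary.PropositionalEquality as ≡
  using (refl; trans; cong; cong₂; subst; subst₂; module ≡-Reasoning)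
open import Relation.Nullary.Decidable using (decidable-stable)

open +-*-Solver using (solve; _:+_; _:*_; _:-_; _:=_)

ℕ→ℚ-nonNeg : ∀ a → NonNegative (ℕ→ℚ a)
ℕ→ℚ-nonNeg a = ℚ.normalize-nonNeg a 1

ℕ→ℚ-pos : ∀ a .{{_ : NonZero a}} → Positive (ℕ→ℚ a)
ℕ→ℚ-pos a = ℚ.normalize-pos a 1

toℚᵘ-ℕ→ℚ : ∀ a → toℚᵘ (ℕ→ℚ a) ℚᵘ.≃ mkℚᵘ (+ a) 0
toℚᵘ-ℕ→ℚ a = ℚ.toℚᵘ-fromℚᵘ (mkℚᵘ (+ a) 0)

ℕ→ℚ-homo-+ : ∀ a b → ℕ→ℚ (a ℕ.+ b) ≡ ℕ→ℚ a + ℕ→ℚ b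
ℕ→ℚ-homo-+ a b = ℚ.toℚᵘ-injective (begin
  toℚᵘ (ℕ→ℚ (a ℕ.+ b))             ≈⟨ toℚᵘ-ℕ→ℚ (a ℕ.+ b) ⟩
  mkℚᵘ (+ (a ℕ.+ b)) 0              ≈⟨ *≡* (cong (ℤ._* + 1) numerators) ⟩
  mkℚᵘ (+ a) 0 ℚᵘ.+ mkℚᵘ (+ b) 0    ≈⟨ ℚᵘ.+-cong (toℚᵘ-ℕ→ℚ a) (toℚᵘ-ℕ→ℚ b) ⟨
  toℚᵘ (ℕ→ℚ a) ℚᵘ.+ toℚᵘ (ℕ→ℚ b)    ≈⟨ ℚ.toℚᵘ-homo-+ (ℕ→ℚ a) (ℕ→ℚ b) ⟨
  toℚᵘ (ℕ→ℚ a + ℕ→ℚ b)             ∎)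
  where
  open ℚᵘ.≃-Reasoning
  numerators : + (a ℕ.+ b) ≡ + a ℤ.* + 1 ℤ.+ + b ℤ.* + 1
  numerators = trans (ℤ.pos-+ a b) (≡.sym (cong₂ ℤ._+_ (ℤ.*-identityʳ (+ a)) (ℤ.*-identityʳ (+ b))))

ℕ→ℚ-mono-≤ : ∀ {a b} → a ℕ.≤ b → ℕ→ℚ a ≤ ℕ→ℚ b
ℕ→ℚ-mono-≤ {a} {b} a≤b = begin
  ℕ→ℚ a                     ≡⟨ ℚ.+-identityʳ (ℕ→ℚ a) ⟨
  ℕ→ℚ a + 0ℚ                ≤⟨ ℚ.+-monoʳ-≤ (ℕ→ℚ a) (ℚ.nonNegative⁻¹ _ {{ℕ→ℚ-nonNeg (b ℕ.∸ a)}}) ⟩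
  ℕ→ℚ a + ℕ→ℚ (b ℕ.∸ a)     ≡⟨ ℕ→ℚ-homo-+ a (b ℕ.∸ a) ⟨
  ℕ→ℚ (a ℕ.+ (b ℕ.∸ a))     ≡⟨ cong ℕ→ℚ (ℕ.m+[n∸m]≡n a≤b) ⟩
  ℕ→ℚ b                     ∎
  where open ℚ.≤-Reasoning

ℕ→ℚ-homo-⊔ : ∀ a b → ℕ→ℚ (a ℕ.⊔ b) ≡ ℕ→ℚ a ℚ.⊔ ℕ→ℚ b
ℕ→ℚ-homo-⊔ a b with ℕ.≤-total a b
... | inj₁ a≤b = trans (cong ℕ→ℚ (ℕ.m≤n⇒m⊔n≡n a≤b)) (≡.sym (ℚ.p≤q⇒p⊔q≡q (ℕ→ℚ-mono-≤ a≤b)))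
... | inj₂ b≤a = trans (cong ℕ→ℚ (ℕ.m≥n⇒m⊔n≡m b≤a)) (≡.sym (ℚ.p≥q⇒p⊔q≡p (ℕ→ℚ-mono-≤ b≤a)))

ℕ→ℚ-homo-⊓ : ∀ a b → ℕ→ℚ (a ℕ.⊓ b) ≡ ℕ→ℚ a ℚ.⊓ ℕ→ℚ b
ℕ→ℚ-homo-⊓ a b with ℕ.≤-total a b
... | inj₁ a≤b = trans (cong ℕ→ℚ (ℕ.m≤n⇒m⊓n≡m a≤b)) (≡.sym (ℚ.p≤q⇒p⊓q≡p (ℕ→ℚ-mono-≤ a≤b)))
... | inj₂ b≤a = trans (cong ℕ→ℚ (ℕ.m≥n⇒m⊓n≡n b≤a)) (≡.sym (ℚ.p≥q⇒p⊓q≡q (ℕ→ℚ-mono-≤ b≤a)))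

ℕ→ℚ-homo-∸ : ∀ {a b} → b ℕ.≤ a → ℕ→ℚ (a ℕ.∸ b) ≡ ℕ→ℚ a - ℕ→ℚ b
ℕ→ℚ-homo-∸ {a} {b} b≤a = begin
  ℕ→ℚ (a ℕ.∸ b)                       ≡⟨ solve 2 (λ x y → x := y :+ x :- y) refl (ℕ→ℚ (a ℕ.∸ b)) (ℕ→ℚ b) ⟩
  ℕ→ℚ b + ℕ→ℚ (a ℕ.∸ b) - ℕ→ℚ b       ≡⟨ cong (_- ℕ→ℚ b) (ℕ→ℚ-homo-+ b (a ℕ.∸ b)) ⟨
  ℕ→ℚ (b ℕ.+ (a ℕ.∸ b)) - ℕ→ℚ b       ≡⟨ cong (λ c → ℕ→ℚ c - ℕ→ℚ b) (ℕ.m+[n∸m]≡n b≤a) ⟩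
  ℕ→ℚ a - ℕ→ℚ b                       ∎
  where open ≡-Reasoning

divℕ-*-cancel : ∀ a s .{{_ : NonZero s}} → divℕ a s * ℕ→ℚ s ≡ ℕ→ℚ a
divℕ-*-cancel a s@(ℕ.suc k) = ℚ.toℚᵘ-injective (begin
  toℚᵘ (divℕ a s * ℕ→ℚ s)              ≈⟨ ℚ.toℚᵘ-homo-* (divℕ a s) (ℕ→ℚ s) ⟩
  toℚᵘ (divℕ a s) ℚᵘ.* toℚᵘ (ℕ→ℚ s)    ≈⟨ ℚᵘ.*-cong (ℚ.toℚᵘ-fromℚᵘ (mkℚᵘ (+ a) k)) (toℚᵘ-ℕ→ℚ s) ⟩
  mkℚᵘ (+ a) k ℚᵘ.* mkℚᵘ (+ s) 0        ≈⟨ *≡* (ℤ.*-assoc (+ a) (+ s) (+ 1)) ⟩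
  mkℚᵘ (+ a) 0                          ≈⟨ toℚᵘ-ℕ→ℚ a ⟨
  toℚᵘ (ℕ→ℚ a)                          ∎)
  where open ℚᵘ.≃-Reasoning

*-distribʳ-- : ∀ p q r → (p - q) * r ≡ p * r - q * r
*-distribʳ-- = solve 3 (λ p q r → (p :- q) :* r := p :* r :- q :* r) refl

p-q+q≡p : ∀ p q → p - q + q ≡ p
p-q+q≡p = solve 2 (λ p q → p :- q :+ q := p) refl

p-q≤0⇒p≤q : ∀ {p q} → p - q ≤ 0ℚ → p ≤ q
p-q≤0⇒p≤q {p} {q} p-q≤0 = subst₂ _≤_ (p-q+q≡p p q) (ℚ.+-identityˡ q) (ℚ.+-monoˡ-≤ q p-q≤0)

p-q<0⇒p<q : ∀ {p q} → p - q < 0ℚ → p < q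
p-q<0⇒p<q {p} {q} p-q<0 = subst₂ _<_ (p-q+q≡p p q) (ℚ.+-identityˡ q) (ℚ.+-monoˡ-< q p-q<0)

p<q⇒p-q<0 : ∀ {p q} → p < q → p - q < 0ℚ
p<q⇒p-q<0 {p} {q} p<q = subst (p - q <_) (ℚ.+-inverseʳ q) (ℚ.+-monoˡ-< (ℚ.- q) p<q)

foldr-map-const : ∀ {A B : Set} (_∙_ : B → B → B) {f : A → B} {z e : B} →
                  z ∙ z ≡ z → (∀ a → f a ≡ z) → e ≡ z → ∀ xs → foldr _∙_ e (map f xs) ≡ z
foldr-map-const _∙_ z∙z≡z f≡z e≡z []       = e≡z
foldr-map-const _∙_ z∙z≡z f≡z e≡z (x ∷ xs) =
  trans (cong₂ _∙_ (f≡z x) (foldr-map-const _∙_ z∙z≡z f≡z e≡z xs)) z∙z≡z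

foldr-⊓≤ : ∀ e xs → foldr ℕ._⊓_ e xs ℕ.≤ e
foldr-⊓≤ e []       = ℕ.≤-refl
foldr-⊓≤ e (x ∷ xs) = ℕ.≤-trans (ℕ.m⊓n≤n x _) (foldr-⊓≤ e xs)

≤foldr-⊔ : ∀ e xs → e ℕ.≤ foldr ℕ._⊔_ e xs
≤foldr-⊔ e []       = ℕ.≤-refl
≤foldr-⊔ e (x ∷ xs) = ℕ.≤-trans (≤foldr-⊔ e xs) (ℕ.m≤n⊔m x _)

minℕ≤maxℕ : ∀ {r} (f : Fin (ℕ.suc r) → ℕ) → minℕ f ℕ.≤ maxℕ f
minℕ≤maxℕ {r} f = ℕ.≤-trans (foldr-⊓≤ (f zero) fs) (≤foldr-⊔ (f zero) fs)
  where
  fs : List ℕ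
  fs = map f (allFin (ℕ.suc r))

module _ (c : ℚ) {A : Set} (f : A → ℚ) (g : A → ℕ) (f*c≡g : ∀ a → f a * c ≡ ℕ→ℚ (g a)) where

  foldr-map-rescale : ∀ (_⊕_ : ℚ → ℚ → ℚ) (_⊞_ : ℕ → ℕ → ℕ) →
                      (∀ x y → (x ⊕ y) * c ≡ (x * c) ⊕ (y * c)) →
                      (∀ a b → ℕ→ℚ (a ⊞ b) ≡ ℕ→ℚ a ⊕ ℕ→ℚ b) →
                      ∀ e e′ → e * c ≡ ℕ→ℚ e′ → ∀ xs →
                      foldr _⊕_ e (map f xs) * c ≡ ℕ→ℚ (foldr _⊞_ e′ (map g xs))
  foldr-map-rescale _⊕_ _⊞_ distrib homo e e′ e*c≡e′ []       = e*c≡e′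
  foldr-map-rescale _⊕_ _⊞_ distrib homo e e′ e*c≡e′ (x ∷ xs) = begin
    (f x ⊕ foldr _⊕_ _ (map f xs)) * c                     ≡⟨ distrib (f x) _ ⟩
    (f x * c) ⊕ (foldr _⊕_ _ (map f xs) * c)               ≡⟨ cong₂ _⊕_ (f*c≡g x) ih ⟩
    ℕ→ℚ (g x) ⊕ ℕ→ℚ (foldr _⊞_ _ (map g xs))               ≡⟨ homo (g x) _ ⟨
    ℕ→ℚ (g x ⊞ foldr _⊞_ _ (map g xs))                     ∎
    where
    open ≡-Reasoning
    ih : foldr _⊕_ e (map f xs) * c ≡ ℕ→ℚ (foldr _⊞_ e′ (map g xs))
    ih = foldr-map-rescale _⊕_ _⊞_ distrib homo e e′ e*c≡e′ xs

module _ {r : ℕ} (f : Fin (ℕ.suc r) → ℚ) (g : Fin (ℕ.suc r) → ℕ) (c : ℚ) .{{_ : NonNegative c}}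
         (f*c≡g : ∀ i → f i * c ≡ ℕ→ℚ (g i)) where

  maxℚ-rescale : maxℚ f * c ≡ ℕ→ℚ (maxℕ g)
  maxℚ-rescale = foldr-map-rescale c f g f*c≡g ℚ._⊔_ ℕ._⊔_ (ℚ.*-distribʳ-⊔-nonNeg c) ℕ→ℚ-homo-⊔
                   (f zero) (g zero) (f*c≡g zero) (allFin (ℕ.suc r))

  minℚ-rescale : minℚ f * c ≡ ℕ→ℚ (minℕ g)
  minℚ-rescale = foldr-map-rescale c f g f*c≡g ℚ._⊓_ ℕ._⊓_ (ℚ.*-distribʳ-⊓-nonNeg c) ℕ→ℚ-homo-⊓
                   (f zero) (g zero) (f*c≡g zero) (allFin (ℕ.suc r))

  sumℚ-rescale : sumℚ f * c ≡ ℕ→ℚ (sum (map g (allFin (ℕ.suc r))))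
  sumℚ-rescale = foldr-map-rescale c f g f*c≡g _+_ ℕ._+_ (ℚ.*-distribʳ-+ c) ℕ→ℚ-homo-+
                   0ℚ 0 (ℚ.*-zeroˡ c) (allFin (ℕ.suc r))

nonempty⇒nonZero : ∀ {n} {p : Subset n} → Nonempty p → NonZero ∣ p ∣
nonempty⇒nonZero {p = inside  ∷ p} _                   = _
nonempty⇒nonZero {p = outside ∷ p} (suc x , there x∈p) = nonempty⇒nonZero (x , x∈p)

m-⊥ : ∀ {n} (G : SimpleGraph n) → m ⊥ G ≡ 0
m-⊥ {n} G = Σᵥ-zeros λ i → Σᵥ-zeros λ j → no-edge i j
  where
  Σᵥ-zeros : {f : Fin n → ℕ} → (∀ i → f i ≡ 0) → Σᵥ f ≡ 0
  Σᵥ-zeros f≡0 = foldr-map-const ℕ._+_ refl f≡0 refl (allFin n)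

  no-edge : ∀ i j → (if (toℕ i <ᵇ toℕ j) ∧ lookup ⊥ i ∧ lookup ⊥ j ∧ adj G i j then 1 else 0) ≡ 0
  no-edge i j rewrite lookup-replicate i false | ∧-zeroʳ (toℕ i <ᵇ toℕ j) = refl

module SDSγ {n r : ℕ} (𝒢 : Graphs n r) where

  b-⊥ : b 𝒢 ⊥ ≡ 0
  b-⊥ = trans (cong (ℕ._∸ minℕ m⊥) max≡0) (ℕ.0∸n≡0 (minℕ m⊥))
    where
    m⊥ : Fin (ℕ.suc r) → ℕ
    m⊥ i = m ⊥ (𝒢 i)
    max≡0 : maxℕ m⊥ ≡ 0
    max≡0 = foldr-map-const ℕ._⊔_ refl (λ i → m-⊥ (𝒢 i)) (m-⊥ (𝒢 zero)) (allFin (ℕ.suc r))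

  objSDSγ-⊥ : ∀ γ → objSDSγ 𝒢 γ ⊥ ≡ 0ℚ
  objSDSγ-⊥ γ rewrite b-⊥ | ∣⊥∣≡0 n | ℚ.*-zeroʳ γ = refl

  feasible-⊥ : ∀ σ → FeasibleSDSγ 𝒢 σ ⊥
  feasible-⊥ σ rewrite ∣⊥∣≡0 n | ℚ.*-zeroʳ σ = ℚ.nonNegative⁻¹ _ {{ℕ→ℚ-nonNeg (mTot 𝒢 ⊥)}}

  module _ {S : Subset n} (S≢∅ : Nonempty S) where

    private
      instance
        |S|≢0 : NonZero ∣ S ∣
        |S|≢0 = nonempty⇒nonZero S≢∅

      s : ℚ
      s = ℕ→ℚ ∣ S ∣

      instance
        s-pos : Positive s
        s-pos = ℕ→ℚ-pos ∣ S ∣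

        s-nonNeg : NonNegative s
        s-nonNeg = ℕ→ℚ-nonNeg ∣ S ∣

      mₛ : Fin (ℕ.suc r) → ℕ
      mₛ i = m S (𝒢 i)

      dᵢ*s≡m : ∀ i → dᵢ 𝒢 S i * s ≡ ℕ→ℚ (mₛ i)
      dᵢ*s≡m i = divℕ-*-cancel (mₛ i) ∣ S ∣

    Δ-rescale : Δ 𝒢 S * s ≡ ℕ→ℚ (b 𝒢 S)
    Δ-rescale = begin
      (maxℚ (dᵢ 𝒢 S) - minℚ (dᵢ 𝒢 S)) * s
        ≡⟨ *-distribʳ-- (maxℚ (dᵢ 𝒢 S)) (minℚ (dᵢ 𝒢 S)) s ⟩
      maxℚ (dᵢ 𝒢 S) * s - minℚ (dᵢ 𝒢 S) * s
        ≡⟨ cong₂ _-_ (maxℚ-rescale (dᵢ 𝒢 S) mₛ s dᵢ*s≡m) (minℚ-rescale (dᵢ 𝒢 S) mₛ s dᵢ*s≡m) ⟩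
      ℕ→ℚ (maxℕ mₛ) - ℕ→ℚ (minℕ mₛ)
        ≡⟨ ℕ→ℚ-homo-∸ (minℕ≤maxℕ mₛ) ⟨
      ℕ→ℚ (b 𝒢 S) ∎
      where open ≡-Reasoning

    d-rescale : d 𝒢 S * s ≡ ℕ→ℚ (mTot 𝒢 S)
    d-rescale = sumℚ-rescale (dᵢ 𝒢 S) mₛ s dᵢ*s≡m

    feasible⇒dense : ∀ {σ} → FeasibleSDSγ 𝒢 σ S → σ ≤ d 𝒢 S
    feasible⇒dense {σ} feasible = ℚ.*-cancelʳ-≤-pos s (subst (σ * s ≤_) (≡.sym d-rescale) feasible)

    dense⇒feasible : ∀ {σ} → σ ≤ d 𝒢 S → FeasibleSDSγ 𝒢 σ S
    dense⇒feasible {σ} σ≤d = subst (σ * s ≤_) d-rescale (ℚ.*-monoʳ-≤-nonNeg s σ≤d)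

    objSDSγ-rescale : ∀ γ → objSDSγ 𝒢 γ S ≡ Δ 𝒢 S * s - γ * s
    objSDSγ-rescale γ = cong (_- γ * s) (≡.sym Δ-rescale)

    objSDSγ≤0⇒Δ≤γ : ∀ {γ} → objSDSγ 𝒢 γ S ≤ 0ℚ → Δ 𝒢 S ≤ γ
    objSDSγ≤0⇒Δ≤γ {γ} obj≤0 =
      ℚ.*-cancelʳ-≤-pos s (p-q≤0⇒p≤q (subst (_≤ 0ℚ) (objSDSγ-rescale γ) obj≤0))

    objSDSγ<0⇒Δ<γ : ∀ {γ} → objSDSγ 𝒢 γ S < 0ℚ → Δ 𝒢 S < γ
    objSDSγ<0⇒Δ<γ {γ} obj<0 =
      ℚ.*-cancelʳ-<-nonNeg s (p-q<0⇒p<q (subst (_< 0ℚ) (objSDSγ-rescale γ) obj<0))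

    Δ<γ⇒objSDSγ<0 : ∀ {γ} → Δ 𝒢 S < γ → objSDSγ 𝒢 γ S < 0ℚ
    Δ<γ⇒objSDSγ<0 {γ} Δ<γ =
      subst (_< 0ℚ) (≡.sym (objSDSγ-rescale γ)) (p<q⇒p-q<0 (ℚ.*-monoˡ-<-pos s Δ<γ))

  optimal-nonempty⇒Δ≤γ : ∀ {σ γ S} → IsOptSDSγ 𝒢 σ γ S → Nonempty S → Δ 𝒢 S ≤ γ
  optimal-nonempty⇒Δ≤γ {σ} {γ} {S} (_ , optimal) S≢∅ =
    objSDSγ≤0⇒Δ≤γ S≢∅ (subst (objSDSγ 𝒢 γ S ≤_) (objSDSγ-⊥ γ) (optimal ⊥ (feasible-⊥ σ)))

  objSDSγ<0⇒nonempty : ∀ {γ S} → objSDSγ 𝒢 γ S < 0ℚ → Nonempty S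
  objSDSγ<0⇒nonempty {γ} {S} obj<0 = decidable-stable (nonempty? S) λ S-empty →
    ℚ.<-irrefl (trans (cong (objSDSγ 𝒢 γ) (Empty-unique S-empty)) (objSDSγ-⊥ γ)) obj<0

proposition5 : (n r : ℕ) (𝒢 : Graphs n r) (σ : ℚ) (S* : Subset n) →
    IsOptSDS 𝒢 σ S* →
    ((γ : ℚ) (S : Subset n) → IsOptSDSγ 𝒢 σ γ S → γ < Δ 𝒢 S* → S ≡ ⊥) ×
    ((γ : ℚ) (S : Subset n) → IsOptSDSγ 𝒢 σ γ S → Δ 𝒢 S* < γ →
      Nonempty S × Δ 𝒢 S < γ)
proposition5 n r 𝒢 σ S* (S*≢∅ , σ≤d[S*] , S*-minimal) = below , above
  where
  open SDSγ 𝒢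

  below : (γ : ℚ) (S : Subset n) → IsOptSDSγ 𝒢 σ γ S → γ < Δ 𝒢 S* → S ≡ ⊥
  below γ S S-optimal γ<Δ[S*] = Empty-unique λ S≢∅ → ℚ.<-irrefl refl (begin-strict
    γ         <⟨ γ<Δ[S*] ⟩
    Δ 𝒢 S*    ≤⟨ S*-minimal S S≢∅ (feasible⇒dense S≢∅ (proj₁ S-optimal)) ⟩
    Δ 𝒢 S     ≤⟨ optimal-nonempty⇒Δ≤γ {σ} {γ} S-optimal S≢∅ ⟩
    γ         ∎)
    where open ℚ.≤-Reasoning

  above : (γ : ℚ) (S : Subset n) → IsOptSDSγ 𝒢 σ γ S → Δ 𝒢 S* < γ →
    Nonempty S × Δ 𝒢 S < γ
  above γ S (_ , optimal) Δ[S*]<γ = S≢∅ , objSDSγ<0⇒Δ<γ S≢∅ {γ} obj<0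
    where
    obj<0 : objSDSγ 𝒢 γ S < 0ℚ
    obj<0 = ℚ.≤-<-trans (optimal S* (dense⇒feasible S*≢∅ σ≤d[S*])) (Δ<γ⇒objSDSγ<0 S*≢∅ Δ[S*]<γ)

    S≢∅ : Nonempty S
    S≢∅ = objSDSγ<0⇒nonempty {γ} obj<0
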